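{- Let $k$ be a positive integer, let $s,t\geq 1$ be integers and let $n\geq k$. Then \[ ex_{bip}(n,K_{s,t},M_{k+1})=\begin{cases} \binom{k}{s}\binom{n}{t}+\binom{k}{t}\binom{n}{s}, & s\neq t,\\[4pt] \binom{k}{s}\binom{n}{s}, & s=t. \end{cases} \]
   Context: All graphs are simple. $M_{k+1}$ denotes a matching with $k+1$ edges and $K_{s,t}$ the complete bipartite graph with parts of sizes $s$ and $t$. For graphs $T$ and $F$, $ex_{bip}(n,T,F)$ denotes the maximum possible number of copies of $T$ (subgraphs isomorphic to $T$) in a bipartite graph with bipartition classes each of size $n$ that contains no subgraph isomorphic to $F$. Binomial coefficients $\binom{a}{b}$ are $0$ when $b>a$. -}

module Defs where

open import Data.Nat using (ℕ; zero; suc; _≡ᵇ_; _≤_)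
open import Data.Empty using (⊥)
open import Data.Bool using (Bool; true; false; _∧_; _∨_; not; if_then_else_)
open import Data.Fin using (Fin)
open import Data.Fin.Subset using (Subset; ∣_∣)
open import Data.Vec using (Vec; []; _∷_; lookup)
open import Data.List using (List; []; _∷_; map; _++_; allFin; cartesianProductWith)
open import Data.Bool.ListAction using (all)
open import Data.Nat.ListAction using (sum)
open import Data.Product using (Σ; _×_; _,_)
open import Function.Definitions using (Injective)
open import Relation.Binary.PropositionalEquality using (_≡_)

-- A bipartite graph with bipartition classes L = Fin n and R = Fin n:
-- G i j = true  iff  the left vertex i is adjacent to the right vertex j.
BipGraph : ℕ → Set
BipGraph n = Fin n → Fin n → Bool

allSubsets : (n : ℕ) → List (Subset n)
allSubsets zero    = [] ∷ []
allSubsets (suc n) = map (false ∷_) (allSubsets n) ++ map (true ∷_) (allSubsets n)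

completeBetween : {n : ℕ} → BipGraph n → Subset n → Subset n → Bool
completeBetween {n} G A B =
  all (λ i → all (λ j → not (lookup A i ∧ lookup B j) ∨ G i j) (allFin n)) (allFin n)

isKst : {n : ℕ} → ℕ → ℕ → BipGraph n → Subset n → Subset n → Bool
isKst s t G A B =
  (((∣ A ∣ ≡ᵇ s) ∧ (∣ B ∣ ≡ᵇ t)) ∨ ((∣ A ∣ ≡ᵇ t) ∧ (∣ B ∣ ≡ᵇ s))) ∧ completeBetween G A B

-- Since K_{s,t} is connected, in a
-- bipartite host each copy has one side inside L and the other inside R, and the
-- copy (as a subgraph, with all s*t edges) is determined by the pair (A ⊆ L, B ⊆ R)
-- of its vertex classes.  So copies correspond exactly to such pairs.
copiesKst : {n : ℕ} → ℕ → ℕ → BipGraph n → ℕ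
copiesKst {n} s t G =
  sum (cartesianProductWith (λ A B → if isKst s t G A B then 1 else 0)
                            (allSubsets n) (allSubsets n))

HasMatching : {n : ℕ} → ℕ → BipGraph n → Set
HasMatching {n} m G =
  Σ (Fin m → Fin n) λ f → Σ (Fin m → Fin n) λ g →
    Injective _≡_ _≡_ f × Injective _≡_ _≡_ g × ((i : Fin m) → G (f i) (g i) ≡ true)

IsExBipKstM : ℕ → ℕ → ℕ → ℕ → ℕ → Set
IsExBipKstM n s t m e =
  ((G : BipGraph n) → (HasMatching m G → ⊥) → copiesKst s t G ≤ e)
  × Σ (BipGraph n) λ G → (HasMatching m G → ⊥) × copiesKst s t G ≡ e

-- By König's theorem an M_{k+1}-free bipartite graph has a vertex cover CL ∪ CR (CL ⊆ L, CR ⊆ R)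
-- with |CL| + |CR| ≤ k.  If A ⊆ L and B ⊆ R span a complete bipartite graph then A ⊆ CL or B ⊆ CR,
-- so at most C(|CL|,s)·C(n,t) + C(n,s)·C(|CR|,t) copies of K_{s,t} have their s-class in L.  Since
-- C(·,s) is superadditive for s ≥ 1, adding the copies with their t-class in L (the same copies when
-- s = t) gives at most C(k,s)·C(n,t) + C(k,t)·C(n,s).  Joining k left vertices to all right vertices
-- attains the bound.
--
-- König's theorem is proved constructively, by induction on the number of edges.  For an edge uv,
-- a matching M and a cover C of G − v with |C| ≤ |M| give the cover C + v of G, which suffices once
-- G has a matching larger than M.  Such a matching is M + uv if u is unmatched; otherwise it is
-- found by recursing on G − ub for a third neighbour b of u, and if u has degree two one recurses
-- on the graph obtained by deleting u and identifying its two neighbours.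
module Submission where

open import Defs
open import Algebra.Properties.CommutativeSemigroup using (interchange)
open import Data.Bool using (Bool; true; false; T; _∧_; _∨_; not; if_then_else_)
open import Data.Bool.ListAction using (all)
open import Data.Bool.Properties
  using (T-≡; T-∧; ∨-idem; ∨-zeroʳ; ∧-zeroʳ; ∧-identityʳ) renaming (_≟_ to _≟ᵇ_)
open import Data.Empty using (⊥; ⊥-elim)
open import Data.Fin using (Fin; zero; suc; toℕ; fromℕ<; inject≤)
open import Data.Fin.Properties
  using (_≟_; any?; injective⇒≤; inject≤-injective; toℕ-injective; toℕ-fromℕ<)
open import Data.Fin.Subset
  using (Subset; outside; inside; ∣_∣; _∈_; _⊆_; _∪_; ⁅_⁆; ⊤; Nonempty) renaming (⊥ to ∅)
open import Data.Fin.Subset.Properties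
  using ( _⊆?_; _∈?_; ⊆⊤; ∣⊤∣≡n; ∣⊥∣≡0; ∉⊥; nonempty?; Empty-unique
        ; ∣p∣≤∣x∷p∣; x∈p∪q⁺; x∈⁅x⁆; ∣⁅x⁆∣≡1)
open import Data.List using ([]; _∷_; _++_; map; allFin; cartesianProductWith)
open import Data.List.Membership.Propositional.Properties using (∈-allFin)
open import Data.List.Properties using (map-++; map-∘; map-cong)
import Data.List.Relation.Unary.All as All
open import Data.List.Relation.Unary.All.Properties using (all⁺; all⁻)
open import Data.Nat
  using (ℕ; zero; suc; _+_; _*_; _≤_; _<_; _≥_; _≤′_; _≡ᵇ_; z≤n; s≤s; ≤′-refl; ≤′-step)
open import Data.Nat.Combinatorics using (_C_; nCk+nC[k+1]≡[n+1]C[k+1])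
open import Data.Nat.Induction using (<-wellFounded)
open import Data.Nat.ListAction using (sum)
open import Data.Nat.ListAction.Properties using (sum-++)
open import Data.Nat.Properties hiding (_≟_)
open import Algebra.Properties.CommutativeMonoid.Sum +-0-commutativeMonoid
  using (sum-syntax; sum-replicate-zero; ∑-distrib-+) renaming (sum to ∑)
open import Data.Nat.Solver using (module +-*-Solver)
open import Data.Product using (_×_; _,_; proj₁; proj₂; ∃; ∃₂; map₂)
open import Data.Sum using (_⊎_; inj₁; inj₂; [_,_]′)
import Data.Sum as Sum
open import Data.Sum.Properties using (inj₁-injective; inj₂-injective; ≡-dec)
open import Data.Vec using ([]; _∷_; lookup; here; there)
open import Data.Vec.Functional using (updateAt; foldr) renaming (_∷_ to _∷ᶠ_)
open import Data.Vec.Functional.Properties using (updateAt-updates; updateAt-minimal)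
open import Data.Vec.Properties using ([]=⇒lookup; lookup⇒[]=)
open import Function using (_∘_; id; const; flip; case_of_; _⇔_; mk⇔; Equivalence; Injective)
open import Function.Construct.Composition using (_⇔-∘_)
import Induction.WellFounded as WF
import Relation.Binary.Construct.On as On
open import Relation.Binary.PropositionalEquality
open import Relation.Nullary using (Dec; yes; no; ¬_; does; proof; contradiction)
open import Relation.Nullary.Decidable
  using (dec-true; dec-false; decidable-stable; _×-dec_; _⊎-dec_; ¬?)
open import Relation.Nullary.Reflects using (det; fromEquivalence)

-- Binomial coefficients

nCk≤[1+n]Ck : ∀ n k → n C k ≤ suc n C k
nCk≤[1+n]Ck n zero    = ≤-refl
nCk≤[1+n]Ck n (suc k) = ≤-trans (m≤n+m (n C suc k) (n C k)) (≤-reflexive (nCk+nC[k+1]≡[n+1]C[k+1] n k))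

C-monoˡ-≤ : ∀ k {m n} → m ≤ n → m C k ≤ n C k
C-monoˡ-≤ k m≤n = go (≤⇒≤′ m≤n)
  where
  go : ∀ {m n} → m ≤′ n → m C k ≤ n C k
  go ≤′-refl        = ≤-refl
  go (≤′-step m≤′n) = ≤-trans (go m≤′n) (nCk≤[1+n]Ck _ k)

mC[1+k]+nC[1+k]≤[m+n]C[1+k] : ∀ m n k → m C suc k + n C suc k ≤ (m + n) C suc k
mC[1+k]+nC[1+k]≤[m+n]C[1+k] m zero k =
  ≤-reflexive (trans (+-identityʳ (m C suc k)) (cong (_C suc k) (sym (+-identityʳ m))))
mC[1+k]+nC[1+k]≤[m+n]C[1+k] m (suc n) k = begin
  m C suc k + suc n C suc k          ≡⟨ cong (m C suc k +_) (nCk+nC[k+1]≡[n+1]C[k+1] n k) ⟨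
  m C suc k + (n C k + n C suc k)    ≡⟨ cong (m C suc k +_) (+-comm (n C k) (n C suc k)) ⟩
  m C suc k + (n C suc k + n C k)    ≡⟨ +-assoc (m C suc k) (n C suc k) (n C k) ⟨
  m C suc k + n C suc k + n C k      ≤⟨ +-mono-≤ (mC[1+k]+nC[1+k]≤[m+n]C[1+k] m n k) (C-monoˡ-≤ k (m≤n+m n m)) ⟩
  (m + n) C suc k + (m + n) C k      ≡⟨ +-comm ((m + n) C suc k) ((m + n) C k) ⟩
  (m + n) C k + (m + n) C suc k      ≡⟨ nCk+nC[k+1]≡[n+1]C[k+1] (m + n) k ⟩
  suc (m + n) C suc k                ≡⟨ cong (_C suc k) (+-suc m n) ⟨
  (m + suc n) C suc k                ∎
  where open ≤-Reasoning

C-superadditive : ∀ {a b k} s → 1 ≤ s → a + b ≤ k → a C s + b C s ≤ k C s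
C-superadditive {a} {b} (suc s) _ a+b≤k =
  ≤-trans (mC[1+k]+nC[1+k]≤[m+n]C[1+k] a b s) (C-monoˡ-≤ (suc s) a+b≤k)

module _ {A : Set} where

  sum-map-cong : ∀ {f g : A → ℕ} → (∀ x → f x ≡ g x) → ∀ xs → sum (map f xs) ≡ sum (map g xs)
  sum-map-cong f≗g xs = cong sum (map-cong f≗g xs)

  sum-map-zero : ∀ xs → sum (map (λ (_ : A) → 0) xs) ≡ 0
  sum-map-zero []       = refl
  sum-map-zero (x ∷ xs) = sum-map-zero xs

  sum-map-mono-≤ : ∀ {f g : A → ℕ} → (∀ x → f x ≤ g x) → ∀ xs → sum (map f xs) ≤ sum (map g xs)
  sum-map-mono-≤ f≤g []       = z≤n
  sum-map-mono-≤ f≤g (x ∷ xs) = +-mono-≤ (f≤g x) (sum-map-mono-≤ f≤g xs)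

  sum-map-+ : ∀ (f g : A → ℕ) xs → sum (map (λ x → f x + g x) xs) ≡ sum (map f xs) + sum (map g xs)
  sum-map-+ f g []       = refl
  sum-map-+ f g (x ∷ xs) = trans (cong (f x + g x +_) (sum-map-+ f g xs))
                                 (interchange +-commutativeSemigroup (f x) (g x) _ _)

  sum-map-*ˡ : ∀ c (f : A → ℕ) xs → sum (map (λ x → c * f x) xs) ≡ c * sum (map f xs)
  sum-map-*ˡ c f []       = sym (*-zeroʳ c)
  sum-map-*ˡ c f (x ∷ xs) = trans (cong (c * f x +_) (sum-map-*ˡ c f xs)) (sym (*-distribˡ-+ c (f x) _))

  sum-map-*ʳ : ∀ (f : A → ℕ) c xs → sum (map (λ x → f x * c) xs) ≡ sum (map f xs) * c
  sum-map-*ʳ f c xs = trans (sum-map-cong (λ x → *-comm (f x) c) xs) (trans (sum-map-*ˡ c f xs) (*-comm c _))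

sum-cartesianProductWith : ∀ {A B : Set} (f : A → B → ℕ) xs ys →
  sum (cartesianProductWith f xs ys) ≡ sum (map (λ x → sum (map (f x) ys)) xs)
sum-cartesianProductWith f []       ys = refl
sum-cartesianProductWith f (x ∷ xs) ys =
  trans (sum-++ (map (f x) ys) _) (cong (sum (map (f x) ys) +_) (sum-cartesianProductWith f xs ys))

∑-mono-≤ : ∀ {n} {f g : Fin n → ℕ} → (∀ i → f i ≤ g i) → ∑ f ≤ ∑ g
∑-mono-≤ {zero}  _   = z≤n
∑-mono-≤ {suc n} f≤g = +-mono-≤ (f≤g zero) (∑-mono-≤ (f≤g ∘ suc))

∑-mono-< : ∀ {n} {f g : Fin n → ℕ} → (∀ i → f i ≤ g i) → ∀ j → f j < g j → ∑ f < ∑ g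
∑-mono-< f≤g zero    fj<gj = +-mono-<-≤ fj<gj (∑-mono-≤ (f≤g ∘ suc))
∑-mono-< f≤g (suc j) fj<gj = +-mono-≤-< (f≤g zero) (∑-mono-< (f≤g ∘ suc) j fj<gj)

pointMass : ∀ {n} → Fin n → ℕ → Fin n → ℕ
pointMass w c y = if does (y ≟ w) then c else 0

∑-pointMass : ∀ {n} (w : Fin n) c → ∑ (pointMass w c) ≡ c
∑-pointMass {suc n} zero    c = trans (cong (c +_) (sum-replicate-zero n)) (+-identityʳ c)
∑-pointMass {suc n} (suc w) c = ∑-pointMass w c

∑-transfer : ∀ {n} (f g : Fin n → ℕ) {v a} → v ≢ a → f a ≡ 0 → f v ≤ g v + g a →
  (∀ y → y ≢ v → y ≢ a → f y ≤ g y) → ∑ f ≤ ∑ g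
∑-transfer f g {v} {a} v≢a fa≡0 fv≤gv+ga f≤g = +-cancelʳ-≤ (g a) (∑ f) (∑ g) (begin
  ∑ f + g a                            ≡⟨ cong (∑ f +_) (∑-pointMass a (g a)) ⟨
  ∑ f + ∑ (pointMass a (g a))          ≡⟨ ∑-distrib-+ f (pointMass a (g a)) ⟨
  ∑ (λ y → f y + pointMass a (g a) y)  ≤⟨ ∑-mono-≤ moved ⟩
  ∑ (λ y → g y + pointMass v (g a) y)  ≡⟨ ∑-distrib-+ g (pointMass v (g a)) ⟩
  ∑ g + ∑ (pointMass v (g a))          ≡⟨ cong (∑ g +_) (∑-pointMass v (g a)) ⟩
  ∑ g + g a                            ∎)
  where
  open ≤-Reasoning
  moved : ∀ y → f y + pointMass a (g a) y ≤ g y + pointMass v (g a) y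
  moved y with y ≟ v | y ≟ a
  ... | yes refl | yes refl = contradiction refl v≢a
  ... | yes refl | no  _    = ≤-trans (≤-reflexive (+-identityʳ (f y))) fv≤gv+ga
  ... | no  _    | yes refl = ≤-reflexive (trans (cong (_+ g y) fa≡0) (sym (+-identityʳ (g y))))
  ... | no  y≢v  | no  y≢a  = +-monoˡ-≤ 0 (f≤g y y≢v y≢a)

ind : Bool → ℕ
ind b = if b then 1 else 0

ind-mono : ∀ {a b} → (a ≡ true → b ≡ true) → ind a ≤ ind b
ind-mono {false} _   = z≤n
ind-mono {true}  a⇒b rewrite a⇒b refl = ≤-refl

ind-∨ : ∀ a b → ind (a ∨ b) ≤ ind a + ind b
ind-∨ false b = ≤-refl
ind-∨ true  b = s≤s z≤n

ind-∨-∧ : ∀ {a b} c → (T a → T b → ⊥) → ind ((a ∨ b) ∧ c) ≡ ind (a ∧ c) + ind (b ∧ c)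
ind-∨-∧ {false}         c _        = refl
ind-∨-∧ {true} {false}  c _        = sym (+-identityʳ _)
ind-∨-∧ {true} {true}   c disjoint = ⊥-elim (disjoint _ _)

ind-∧-≤ : ∀ a b {c p q} → (T c → T p ⊎ T q) → ind ((a ∧ b) ∧ c) ≤ ind (a ∧ p) * ind b + ind a * ind (b ∧ q)
ind-∧-≤ false b                          _ = z≤n
ind-∧-≤ true  false                      _ = z≤n
ind-∧-≤ true  true {false}               _ = z≤n
ind-∧-≤ true  true {true} {true}         _ = s≤s z≤n
ind-∧-≤ true  true {true} {false} {true} _ = s≤s z≤n
ind-∧-≤ true  true {true} {false} {false} c⇒p⊎q with c⇒p⊎q _
... | inj₁ ()
... | inj₂ ()

ind-∧-≡ : ∀ a b {c p} → (T b → c ≡ p) → ind ((a ∧ b) ∧ c) ≡ ind (a ∧ p) * ind b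
ind-∧-≡ false b              _   = refl
ind-∧-≡ true  false {p = p}  _   = sym (*-zeroʳ (ind p))
ind-∧-≡ true  true  {p = p}  c≡p = trans (cong ind (c≡p _)) (sym (*-identityʳ (ind p)))

module _ {n : ℕ} where

  subsetSum : (Subset n → ℕ) → ℕ
  subsetSum f = sum (map f (allSubsets n))

  pairSum : (Subset n → Subset n → ℕ) → ℕ
  pairSum f = subsetSum λ A → subsetSum (f A)

  pairSum-mono-≤ : ∀ {f g} → (∀ A B → f A B ≤ g A B) → pairSum f ≤ pairSum g
  pairSum-mono-≤ f≤g = sum-map-mono-≤ (λ A → sum-map-mono-≤ (f≤g A) (allSubsets n)) (allSubsets n)

  pairSum-cong : ∀ {f g} → (∀ A B → f A B ≡ g A B) → pairSum f ≡ pairSum g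
  pairSum-cong f≗g = sum-map-cong (λ A → sum-map-cong (f≗g A) (allSubsets n)) (allSubsets n)

  pairSum-+ : ∀ f g → pairSum (λ A B → f A B + g A B) ≡ pairSum f + pairSum g
  pairSum-+ f g = trans (sum-map-cong (λ A → sum-map-+ (f A) (g A) (allSubsets n)) (allSubsets n))
                        (sum-map-+ (λ A → subsetSum (f A)) (λ A → subsetSum (g A)) (allSubsets n))

  pairSum-* : ∀ f g → pairSum (λ A B → f A * g B) ≡ subsetSum f * subsetSum g
  pairSum-* f g = trans (sum-map-cong (λ A → sum-map-*ˡ (f A) g (allSubsets n)) (allSubsets n))
                        (sum-map-*ʳ f (subsetSum g) (allSubsets n))

subsetSum-suc : ∀ {n} (f : Subset (suc n) → ℕ) →
  subsetSum f ≡ subsetSum (f ∘ (outside ∷_)) + subsetSum (f ∘ (inside ∷_))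
subsetSum-suc {n} f = begin
  sum (map f (map (outside ∷_) L ++ map (inside ∷_) L))
    ≡⟨ cong sum (map-++ f (map (outside ∷_) L) _) ⟩
  sum (map f (map (outside ∷_) L) ++ map f (map (inside ∷_) L))
    ≡⟨ sum-++ (map f (map (outside ∷_) L)) _ ⟩
  sum (map f (map (outside ∷_) L)) + sum (map f (map (inside ∷_) L))
    ≡⟨ cong₂ _+_ (cong sum (map-∘ L)) (cong sum (map-∘ L)) ⟨
  subsetSum (f ∘ (outside ∷_)) + subsetSum (f ∘ (inside ∷_)) ∎
  where
  open ≡-Reasoning
  L = allSubsets n

subsetSum-zero : ∀ {n} → subsetSum {n} (λ _ → 0) ≡ 0
subsetSum-zero {n} = sum-map-zero (allSubsets n)

ofSize : ∀ {n} → ℕ → Subset n → Bool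
ofSize s A = ∣ A ∣ ≡ᵇ s

within : ∀ {n} → Subset n → Subset n → Bool
within P A = does (A ⊆? P)

#subsetsOfSizeWithin : ∀ {n} (P : Subset n) s → subsetSum (λ A → ind (ofSize s A ∧ within P A)) ≡ ∣ P ∣ C s
#subsetsOfSizeWithin []            zero    = refl
#subsetsOfSizeWithin []            (suc s) = refl
#subsetsOfSizeWithin {suc n} (outside ∷ P) s =
  trans (subsetSum-suc (λ A → ind (ofSize s A ∧ within (outside ∷ P) A)))
        (trans (cong₂ _+_ (#subsetsOfSizeWithin P s)
                          (trans (sum-map-cong (λ A → cong ind (∧-zeroʳ (ofSize s (inside ∷ A)))) (allSubsets n))
                                 (subsetSum-zero {n})))
               (+-identityʳ _))
#subsetsOfSizeWithin {suc n} (inside ∷ P) zero =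
  trans (subsetSum-suc (λ A → ind (ofSize 0 A ∧ within (inside ∷ P) A)))
        (cong₂ _+_ (#subsetsOfSizeWithin P zero) (subsetSum-zero {n}))
#subsetsOfSizeWithin (inside ∷ P)  (suc s) =
  trans (subsetSum-suc (λ A → ind (ofSize (suc s) A ∧ within (inside ∷ P) A)))
        (trans (cong₂ _+_ (#subsetsOfSizeWithin P (suc s)) (#subsetsOfSizeWithin P s))
               (trans (+-comm (∣ P ∣ C suc s) (∣ P ∣ C s)) (nCk+nC[k+1]≡[n+1]C[k+1] ∣ P ∣ s)))

#subsetsOfSize : ∀ n s → subsetSum {n} (λ A → ind (ofSize s A)) ≡ n C s
#subsetsOfSize n s = begin
  subsetSum {n} (λ A → ind (ofSize s A))              ≡⟨ sum-map-cong within⊤ (allSubsets n) ⟨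
  subsetSum {n} (λ A → ind (ofSize s A ∧ within ⊤ A)) ≡⟨ #subsetsOfSizeWithin (⊤ {n}) s ⟩
  ∣ ⊤ {n} ∣ C s                                        ≡⟨ cong (_C s) (∣⊤∣≡n n) ⟩
  n C s                                                ∎
  where
  open ≡-Reasoning
  within⊤ : ∀ (A : Subset n) → ind (ofSize s A ∧ within ⊤ A) ≡ ind (ofSize s A)
  within⊤ A = cong ind (trans (cong (ofSize s A ∧_) (dec-true (A ⊆? ⊤) ⊆⊤)) (∧-identityʳ _))

Complete : ∀ {n} → BipGraph n → Subset n → Subset n → Set
Complete G A B = ∀ {x y} → x ∈ A → y ∈ B → G x y ≡ true

completeBetween⇔Complete : ∀ {n} {G : BipGraph n} {A B} → T (completeBetween G A B) ⇔ Complete G A B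
completeBetween⇔Complete {n} {G} {A} {B} = mk⇔ elim intro
  where
  entry : Fin n → Fin n → Bool
  entry x y = not (lookup A x ∧ lookup B y) ∨ G x y

  row : Fin n → Bool
  row x = all (entry x) (allFin n)

  elim : T (completeBetween G A B) → Complete G A B
  elim complete {x} {y} x∈A y∈B =
    Equivalence.to T-≡ (subst T (cong₂ (λ a b → not (a ∧ b) ∨ G x y) ([]=⇒lookup x∈A) ([]=⇒lookup y∈B)) cell)
    where
    cell : T (entry x y)
    cell = All.lookup (all⁺ (entry x) (allFin n) (All.lookup (all⁺ row (allFin n) complete) (∈-allFin x)))
                      (∈-allFin y)

  intro : Complete G A B → T (completeBetween G A B)
  intro complete =
    all⁻ row {xs = allFin n} (All.tabulate λ {x} _ →
      all⁻ (entry x) {xs = allFin n} (All.tabulate λ {y} _ → cell x y))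
    where
    cell : ∀ x y → T (entry x y)
    cell x y with lookup A x in Ax | lookup B y in By
    ... | false | _     = _
    ... | true  | false = _
    ... | true  | true  = Equivalence.from T-≡ (complete (lookup⇒[]= x A Ax) (lookup⇒[]= y B By))

isLeftKst : ∀ {n} → ℕ → ℕ → BipGraph n → Subset n → Subset n → Bool
isLeftKst s t G A B = (ofSize s A ∧ ofSize t B) ∧ completeBetween G A B

leftCopiesKst : ∀ {n} → ℕ → ℕ → BipGraph n → ℕ
leftCopiesKst s t G = pairSum λ A B → ind (isLeftKst s t G A B)

copiesKst≡pairSum : ∀ {n} s t (G : BipGraph n) → copiesKst s t G ≡ pairSum (λ A B → ind (isKst s t G A B))
copiesKst≡pairSum {n} s t G = sum-cartesianProductWith _ (allSubsets n) (allSubsets n)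

copiesKst-≢ : ∀ {n} {s t} (G : BipGraph n) → s ≢ t →
  copiesKst s t G ≡ leftCopiesKst s t G + leftCopiesKst t s G
copiesKst-≢ {s = s} {t} G s≢t =
  trans (copiesKst≡pairSum s t G)
        (trans (pairSum-cong λ A B → ind-∨-∧ (completeBetween G A B) (disjoint A B))
               (pairSum-+ (λ A B → ind (isLeftKst s t G A B)) (λ A B → ind (isLeftKst t s G A B))))
  where
  disjoint : ∀ A B → T (ofSize s A ∧ ofSize t B) → T (ofSize t A ∧ ofSize s B) → ⊥
  disjoint A B As×Bt At×Bs = s≢t (trans (sym (≡ᵇ⇒≡ ∣ A ∣ s (proj₁ (Equivalence.to T-∧ As×Bt))))
                                        (≡ᵇ⇒≡ ∣ A ∣ t (proj₁ (Equivalence.to T-∧ At×Bs))))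

copiesKst-≡ : ∀ {n} {s} (G : BipGraph n) → copiesKst s s G ≡ leftCopiesKst s s G
copiesKst-≡ {s = s} G =
  trans (copiesKst≡pairSum s s G) (pairSum-cong λ A B → cong (λ b → ind (b ∧ completeBetween G A B)) (∨-idem _))

∷-injective : ∀ {A : Set} {m} {x : A} {f : Fin m → A} →
  Injective _≡_ _≡_ f → (∀ i → f i ≢ x) → Injective _≡_ _≡_ (x ∷ᶠ f)
∷-injective f-injective x-new {zero}  {zero}  _      = refl
∷-injective f-injective x-new {zero}  {suc j} x≡fj   = contradiction (sym x≡fj) (x-new j)
∷-injective f-injective x-new {suc i} {zero}  fi≡x   = contradiction fi≡x (x-new i)
∷-injective f-injective x-new {suc i} {suc j} fi≡fj  = cong suc (f-injective fi≡fj)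

record Matching {n} (m : ℕ) (G : BipGraph n) : Set where
  field
    leftEnd rightEnd   : Fin m → Fin n
    leftEnd-injective  : Injective _≡_ _≡_ leftEnd
    rightEnd-injective : Injective _≡_ _≡_ rightEnd
    matched            : ∀ i → G (leftEnd i) (rightEnd i) ≡ true

open Matching

Matching⇒HasMatching : ∀ {n m} {G : BipGraph n} → Matching m G → HasMatching m G
Matching⇒HasMatching M = leftEnd M , rightEnd M , leftEnd-injective M , rightEnd-injective M , matched M

emptyMatching : ∀ {n} {G : BipGraph n} → Matching 0 G
emptyMatching = record
  { leftEnd            = λ ()
  ; rightEnd           = λ ()
  ; leftEnd-injective  = λ { {()} }
  ; rightEnd-injective = λ { {()} }
  ; matched            = λ ()
  }

Matching-transfer : ∀ {n m} {H G : BipGraph n} (M : Matching m H) →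
  (∀ i → G (leftEnd M i) (rightEnd M i) ≡ true) → Matching m G
Matching-transfer M edges = record { Matching M; matched = edges }

Matching-≤ : ∀ {n m m′} {G : BipGraph n} → m′ ≤ m → Matching m G → Matching m′ G
Matching-≤ m′≤m M = record
  { leftEnd            = leftEnd M ∘ embed
  ; rightEnd           = rightEnd M ∘ embed
  ; leftEnd-injective  = embed-injective ∘ leftEnd-injective M
  ; rightEnd-injective = embed-injective ∘ rightEnd-injective M
  ; matched            = matched M ∘ embed
  }
  where
  embed = λ i → inject≤ i m′≤m
  embed-injective : Injective _≡_ _≡_ embed
  embed-injective = inject≤-injective m′≤m m′≤m _ _

Matching-∷ : ∀ {n m} {G : BipGraph n} {u v} (M : Matching m G) → G u v ≡ true →
  (∀ i → leftEnd M i ≢ u) → (∀ i → rightEnd M i ≢ v) → Matching (suc m) G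
Matching-∷ {u = u} {v} M uv u-new v-new = record
  { leftEnd            = u ∷ᶠ leftEnd M
  ; rightEnd           = v ∷ᶠ rightEnd M
  ; leftEnd-injective  = ∷-injective (leftEnd-injective M) u-new
  ; rightEnd-injective = ∷-injective (rightEnd-injective M) v-new
  ; matched            = λ { zero → uv ; (suc i) → matched M i }
  }

Matching-rematch : ∀ {n m} {H G : BipGraph n} (M : Matching m H) (i₁ : Fin m) {w} →
  (∀ i → i ≢ i₁ → rightEnd M i ≢ w) → (∀ i → i ≢ i₁ → G (leftEnd M i) (rightEnd M i) ≡ true) →
  G (leftEnd M i₁) w ≡ true → Matching m G
Matching-rematch {G = G} M i₁ {w} w-new edges edge₁ = record
  { leftEnd            = leftEnd M
  ; rightEnd           = right
  ; leftEnd-injective  = leftEnd-injective M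
  ; rightEnd-injective = right-injective
  ; matched            = edge
  }
  where
  right = updateAt (rightEnd M) i₁ (const w)

  right-i₁ : right i₁ ≡ w
  right-i₁ = updateAt-updates i₁ (rightEnd M)

  right-other : ∀ i → i ≢ i₁ → right i ≡ rightEnd M i
  right-other i i≢i₁ = updateAt-minimal i i₁ (rightEnd M) i≢i₁

  right-injective : Injective _≡_ _≡_ right
  right-injective {i} {j} eq with i ≟ i₁ | j ≟ i₁
  ... | yes refl | yes refl = refl
  ... | yes refl | no j≢i₁  = contradiction (trans (sym (right-other j j≢i₁)) (trans (sym eq) right-i₁)) (w-new j j≢i₁)
  ... | no i≢i₁  | yes refl = contradiction (trans (sym (right-other i i≢i₁)) (trans eq right-i₁)) (w-new i i≢i₁)
  ... | no i≢i₁  | no j≢i₁  =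
    rightEnd-injective M (trans (sym (right-other i i≢i₁)) (trans eq (right-other j j≢i₁)))

  edge : ∀ i → G (leftEnd M i) (right i) ≡ true
  edge i with i ≟ i₁
  ... | yes refl = subst (λ y → G (leftEnd M i) y ≡ true) (sym right-i₁) edge₁
  ... | no i≢i₁  = subst (λ y → G (leftEnd M i) y ≡ true) (sym (right-other i i≢i₁)) (edges i i≢i₁)

IsVertexCover : ∀ {n} → BipGraph n → Subset n → Subset n → Set
IsVertexCover G CL CR = ∀ {x y} → G x y ≡ true → x ∈ CL ⊎ y ∈ CR

Complete⇒⊆⊎⊆ : ∀ {n} {G : BipGraph n} {CL CR A B} → IsVertexCover G CL CR → Complete G A B → A ⊆ CL ⊎ B ⊆ CR
Complete⇒⊆⊎⊆ {CL = CL} {CR} {A} cover complete with A ⊆? CL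
... | yes A⊆CL = inj₁ A⊆CL
... | no  A⊈CL = inj₂ λ {y} y∈B → decidable-stable (y ∈? CR) λ y∉CR →
  A⊈CL λ x∈A → [ id , flip contradiction y∉CR ]′ (cover (complete x∈A y∈B))

Vertex : ℕ → Set
Vertex n = Fin n ⊎ Fin n

infix 4 _∈ᵛ_ _∈ᵛ?_

_∈ᵛ_ : ∀ {n c} → Vertex n → (Fin c → Vertex n) → Set
w ∈ᵛ C = ∃ λ j → C j ≡ w

_∈ᵛ?_ : ∀ {n c} (w : Vertex n) (C : Fin c → Vertex n) → Dec (w ∈ᵛ C)
w ∈ᵛ? C = any? λ j → ≡-dec _≟_ _≟_ (C j) w

∈ᵛ-here : ∀ {n c} {w : Vertex n} {C : Fin c → Vertex n} → w ∈ᵛ w ∷ᶠ C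
∈ᵛ-here = zero , refl

∈ᵛ-there : ∀ {n c} {w w′ : Vertex n} {C : Fin c → Vertex n} → w ∈ᵛ C → w ∈ᵛ w′ ∷ᶠ C
∈ᵛ-there (j , Cj≡w) = suc j , Cj≡w

-- Within König's proof a cover is a family of c vertices (repetitions allowed), so that its size can
-- be compared with a matching by an injection into Fin c; it is turned into a pair of subsets at the end.
CoveredBy : ∀ {n c} → BipGraph n → (Fin c → Vertex n) → Set
CoveredBy G C = ∀ {x y} → G x y ≡ true → inj₁ x ∈ᵛ C ⊎ inj₂ y ∈ᵛ C

CoveredBy-∷ : ∀ {n c} {G : BipGraph n} {C : Fin c → Vertex n} {w} → CoveredBy G C → CoveredBy G (w ∷ᶠ C)
CoveredBy-∷ covers = Sum.map ∈ᵛ-there ∈ᵛ-there ∘ covers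

cover-exceeds-matching : ∀ {n m c} {G : BipGraph n} {C : Fin c → Vertex n} {v} (M : Matching m G) →
  CoveredBy G C → inj₂ v ∈ᵛ C → (∀ i → rightEnd M i ≢ v) → suc m ≤ c
cover-exceeds-matching {n} {m} {c} {C = C} M covers (j₀ , Cj₀≡v) v-unmatched = injective⇒≤ index-injective
  where
  EndOf : Fin m → Vertex n → Set
  EndOf i w = w ≡ inj₁ (leftEnd M i) ⊎ w ≡ inj₂ (rightEnd M i)

  end-unique : ∀ {i i′ w} → EndOf i w → EndOf i′ w → i ≡ i′
  end-unique (inj₁ refl) (inj₁ eq) = leftEnd-injective M (inj₁-injective eq)
  end-unique (inj₂ refl) (inj₂ eq) = rightEnd-injective M (inj₂-injective eq)
  end-unique (inj₁ refl) (inj₂ ())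
  end-unique (inj₂ refl) (inj₁ ())

  coverOf : ∀ i → ∃ λ j → EndOf i (C j)
  coverOf i = [ map₂ inj₁ , map₂ inj₂ ]′ (covers (matched M i))

  coverOf-injective : Injective _≡_ _≡_ (proj₁ ∘ coverOf)
  coverOf-injective {i} {i′} eq =
    end-unique (proj₂ (coverOf i)) (subst (λ j → EndOf i′ (C j)) (sym eq) (proj₂ (coverOf i′)))

  v-unmatched′ : ∀ i → ¬ EndOf i (C j₀)
  v-unmatched′ i (inj₁ eq) = case trans (sym Cj₀≡v) eq of λ ()
  v-unmatched′ i (inj₂ eq) = v-unmatched i (sym (inj₂-injective (trans (sym Cj₀≡v) eq)))

  index-injective : Injective _≡_ _≡_ (j₀ ∷ᶠ (proj₁ ∘ coverOf))
  index-injective = ∷-injective coverOf-injective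
    (λ i eq → v-unmatched′ i (subst (λ j → EndOf i (C j)) eq (proj₂ (coverOf i))))

∣p∪q∣≤∣p∣+∣q∣ : ∀ {n} (p q : Subset n) → ∣ p ∪ q ∣ ≤ ∣ p ∣ + ∣ q ∣
∣p∪q∣≤∣p∣+∣q∣ []            []            = z≤n
∣p∪q∣≤∣p∣+∣q∣ (outside ∷ p) (outside ∷ q) = ∣p∪q∣≤∣p∣+∣q∣ p q
∣p∪q∣≤∣p∣+∣q∣ (outside ∷ p) (inside  ∷ q) =
  ≤-trans (s≤s (∣p∪q∣≤∣p∣+∣q∣ p q)) (≤-reflexive (sym (+-suc ∣ p ∣ ∣ q ∣)))
∣p∪q∣≤∣p∣+∣q∣ (inside  ∷ p) (x       ∷ q) =
  s≤s (≤-trans (∣p∪q∣≤∣p∣+∣q∣ p q) (+-monoʳ-≤ ∣ p ∣ (∣p∣≤∣x∷p∣ x q)))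

_∈ᴾ_ : ∀ {n} → Vertex n → Subset n × Subset n → Set
inj₁ x ∈ᴾ (L , R) = x ∈ L
inj₂ y ∈ᴾ (L , R) = y ∈ R

∣_∣ᴾ : ∀ {n} → Subset n × Subset n → ℕ
∣ L , R ∣ᴾ = ∣ L ∣ + ∣ R ∣

insertVertex : ∀ {n} → Vertex n → Subset n × Subset n → Subset n × Subset n
insertVertex (inj₁ x) (L , R) = ⁅ x ⁆ ∪ L , R
insertVertex (inj₂ y) (L , R) = L , ⁅ y ⁆ ∪ R

∈ᴾ-insertVertex : ∀ {n} (w : Vertex n) P → w ∈ᴾ insertVertex w P
∈ᴾ-insertVertex (inj₁ x) _ = x∈p∪q⁺ (inj₁ (x∈⁅x⁆ x))
∈ᴾ-insertVertex (inj₂ y) _ = x∈p∪q⁺ (inj₁ (x∈⁅x⁆ y))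

insertVertex-⊇ : ∀ {n} {w : Vertex n} w′ P → w ∈ᴾ P → w ∈ᴾ insertVertex w′ P
insertVertex-⊇ {w = inj₁ _} (inj₁ _) _ x∈L = x∈p∪q⁺ (inj₂ x∈L)
insertVertex-⊇ {w = inj₁ _} (inj₂ _) _ x∈L = x∈L
insertVertex-⊇ {w = inj₂ _} (inj₁ _) _ y∈R = y∈R
insertVertex-⊇ {w = inj₂ _} (inj₂ _) _ y∈R = x∈p∪q⁺ (inj₂ y∈R)

size-insertVertex : ∀ {n} (w : Vertex n) P → ∣ insertVertex w P ∣ᴾ ≤ suc ∣ P ∣ᴾ
size-insertVertex (inj₁ x) (L , R) =
  +-monoˡ-≤ ∣ R ∣ (≤-trans (∣p∪q∣≤∣p∣+∣q∣ ⁅ x ⁆ L) (≤-reflexive (cong (_+ ∣ L ∣) (∣⁅x⁆∣≡1 x))))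
size-insertVertex (inj₂ y) (L , R) = begin
  ∣ L ∣ + ∣ ⁅ y ⁆ ∪ R ∣  ≤⟨ +-monoʳ-≤ ∣ L ∣ (∣p∪q∣≤∣p∣+∣q∣ ⁅ y ⁆ R) ⟩
  ∣ L ∣ + (∣ ⁅ y ⁆ ∣ + ∣ R ∣)  ≡⟨ cong (λ s → ∣ L ∣ + (s + ∣ R ∣)) (∣⁅x⁆∣≡1 y) ⟩
  ∣ L ∣ + suc ∣ R ∣   ≡⟨ +-suc ∣ L ∣ ∣ R ∣ ⟩
  suc (∣ L ∣ + ∣ R ∣) ∎
  where open ≤-Reasoning

vertexSubsets : ∀ {n c} → (Fin c → Vertex n) → Subset n × Subset n
vertexSubsets = foldr insertVertex (∅ , ∅)

∈ᵛ⇒∈ᴾ : ∀ {n c} {C : Fin c → Vertex n} {w} → w ∈ᵛ C → w ∈ᴾ vertexSubsets C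
∈ᵛ⇒∈ᴾ {C = C} (zero  , refl) = ∈ᴾ-insertVertex (C zero) (vertexSubsets (C ∘ suc))
∈ᵛ⇒∈ᴾ {C = C} (suc j , Cj≡w) = insertVertex-⊇ (C zero) (vertexSubsets (C ∘ suc)) (∈ᵛ⇒∈ᴾ (j , Cj≡w))

size-vertexSubsets : ∀ {n c} (C : Fin c → Vertex n) → ∣ vertexSubsets C ∣ᴾ ≤ c
size-vertexSubsets {n} {zero}  C = ≤-reflexive (cong₂ _+_ (∣⊥∣≡0 n) (∣⊥∣≡0 n))
size-vertexSubsets {n} {suc c} C =
  ≤-trans (size-insertVertex (C zero) (vertexSubsets (C ∘ suc))) (s≤s (size-vertexSubsets (C ∘ suc)))

CoveredBy⇒IsVertexCover : ∀ {n c} {G : BipGraph n} {C : Fin c → Vertex n} →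
  CoveredBy G C → IsVertexCover G (proj₁ (vertexSubsets C)) (proj₂ (vertexSubsets C))
CoveredBy⇒IsVertexCover covers = Sum.map ∈ᵛ⇒∈ᴾ ∈ᵛ⇒∈ᴾ ∘ covers

-- König's theorem

edgeCount : ∀ {n} → BipGraph n → ℕ
edgeCount {n} G = ∑[ x < n ] ∑[ y < n ] ind (G x y)

_⊆ᴳ_ : ∀ {n} → BipGraph n → BipGraph n → Set
H ⊆ᴳ G = ∀ {x y} → H x y ≡ true → G x y ≡ true

edgeCount-< : ∀ {n} {H G : BipGraph n} {u v} → H ⊆ᴳ G → H u v ≡ false → G u v ≡ true →
  edgeCount H < edgeCount G
edgeCount-< {H = H} {G} {u} {v} H⊆G ¬Huv Guv =
  ∑-mono-< (λ x → ∑-mono-≤ (cell x)) u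
           (∑-mono-< (cell u) v (subst₂ (λ h g → ind h < ind g) (sym ¬Huv) (sym Guv) ≤-refl))
  where
  cell : ∀ x y → ind (H x y) ≤ ind (G x y)
  cell x y = ind-mono H⊆G

opaque
  _∖_ : ∀ {n} {D : Fin n → Fin n → Set} → BipGraph n → (∀ x y → Dec (D x y)) → BipGraph n
  (G ∖ D?) x y = G x y ∧ not (does (D? x y))

module _ {n} {G : BipGraph n} {D : Fin n → Fin n → Set} (D? : ∀ x y → Dec (D x y)) where

  opaque
    unfolding _∖_

    ∖-edge⁻ : ∀ {x y} → (G ∖ D?) x y ≡ true → G x y ≡ true × ¬ D x y
    ∖-edge⁻ {x} {y} _ with G x y | D? x y
    ∖-edge⁻ _  | true  | no ¬d = refl , ¬d
    ∖-edge⁻ () | true  | yes _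
    ∖-edge⁻ () | false | _

    ∖-edge⁺ : ∀ {x y} → G x y ≡ true → ¬ D x y → (G ∖ D?) x y ≡ true
    ∖-edge⁺ {x} {y} Gxy ¬d rewrite Gxy | dec-false (D? x y) ¬d = refl

    ∖-deleted : ∀ {x y} → D x y → (G ∖ D?) x y ≡ false
    ∖-deleted {x} {y} d rewrite dec-true (D? x y) d = ∧-zeroʳ (G x y)

  ∖-⊆ : (G ∖ D?) ⊆ᴳ G
  ∖-⊆ e = proj₁ (∖-edge⁻ e)

  edgeCount-∖ : ∀ {u v} → G u v ≡ true → D u v → edgeCount (G ∖ D?) < edgeCount G
  edgeCount-∖ Guv d = edgeCount-< {H = G ∖ D?} {G} ∖-⊆ (∖-deleted d) Guv

CoveredBy-∖ : ∀ {n c} {G : BipGraph n} {C : Fin c → Vertex n} {D : Fin n → Fin n → Set}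
  (D? : ∀ x y → Dec (D x y)) → CoveredBy (G ∖ D?) C → (∀ {x y} → D x y → inj₁ x ∈ᵛ C ⊎ inj₂ y ∈ᵛ C) → CoveredBy G C
CoveredBy-∖ {G = G} D? covers coversD {x} {y} Gxy with D? x y
... | yes d  = coversD d
... | no  ¬d = covers (∖-edge⁺ {G = G} D? Gxy ¬d)

record KönigPair {n} (G : BipGraph n) : Set where
  constructor königPair
  field
    {matchingSize coverSize} : ℕ
    matching       : Matching matchingSize G
    cover          : Fin coverSize → Vertex n
    covers         : CoveredBy G cover
    cover≤matching : coverSize ≤ matchingSize

module Contraction {n} (G : BipGraph n) {u v a : Fin n} (uv : G u v ≡ true) (ua : G u a ≡ true) (a≢v : a ≢ v)
                   (N[u]⊆va : ∀ {y} → G u y ≡ true → y ≡ v ⊎ y ≡ a) where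

  -- u is deleted and a is merged into v.
  opaque
    contracted : BipGraph n
    contracted x y =
      not (does (x ≟ u)) ∧ (if does (y ≟ v) then G x v ∨ G x a else not (does (y ≟ a)) ∧ G x y)

  opaque
    unfolding contracted

    contracted-u : ∀ y → contracted u y ≡ false
    contracted-u y rewrite dec-true (u ≟ u) refl = refl

    contracted-a : ∀ x → contracted x a ≡ false
    contracted-a x rewrite dec-false (a ≟ v) a≢v | dec-true (a ≟ a) refl = ∧-zeroʳ _

    contracted-v : ∀ {x} → x ≢ u → contracted x v ≡ G x v ∨ G x a
    contracted-v {x} x≢u rewrite dec-false (x ≟ u) x≢u | dec-true (v ≟ v) refl = refl

    contracted-other : ∀ {x y} → x ≢ u → y ≢ v → y ≢ a → contracted x y ≡ G x y
    contracted-other {x} {y} x≢u y≢v y≢a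
      rewrite dec-false (x ≟ u) x≢u | dec-false (y ≟ v) y≢v | dec-false (y ≟ a) y≢a = refl

  edge⇒≢u : ∀ {x y} → contracted x y ≡ true → x ≢ u
  edge⇒≢u {y = y} e refl = case trans (sym e) (contracted-u y) of λ ()

  edge⇒≢a : ∀ {x y} → contracted x y ≡ true → y ≢ a
  edge⇒≢a {x} e refl = case trans (sym e) (contracted-a x) of λ ()

  edge⇒G : ∀ {x y} → contracted x y ≡ true → y ≢ v → G x y ≡ true
  edge⇒G e y≢v = trans (sym (contracted-other (edge⇒≢u e) y≢v (edge⇒≢a e))) e

  edgeCount-contracted : edgeCount contracted < edgeCount G
  edgeCount-contracted =
    ∑-mono-< row-≤ u
             (∑-mono-< cell-u v (subst₂ (λ c g → ind c < ind g) (sym (contracted-u v)) (sym uv) ≤-refl))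
    where
    cell-u : ∀ y → ind (contracted u y) ≤ ind (G u y)
    cell-u y rewrite contracted-u y = z≤n

    row-≤ : ∀ x → ∑ (λ y → ind (contracted x y)) ≤ ∑ (λ y → ind (G x y))
    row-≤ x = case x ≟ u of λ where
      (yes refl) → ∑-mono-≤ cell-u
      (no x≢u)   → ∑-transfer (λ y → ind (contracted x y)) (λ y → ind (G x y)) (a≢v ∘ sym)
        (cong ind (contracted-a x))
        (subst (λ c → ind c ≤ ind (G x v) + ind (G x a)) (sym (contracted-v x≢u)) (ind-∨ (G x v) (G x a)))
        (λ y y≢v y≢a → ≤-reflexive (cong ind (contracted-other x≢u y≢v y≢a)))

  liftCover : ∀ {c} {C : Fin c → Vertex n} → CoveredBy contracted C → ∃ λ w → CoveredBy G (w ∷ᶠ C)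
  liftCover {C = C} covers with inj₂ v ∈ᵛ? C
  ... | yes v∈C = inj₂ a , covers-a
    where
    covers-a : CoveredBy G (inj₂ a ∷ᶠ C)
    covers-a {x} {y} Gxy with x ≟ u | y ≟ v | y ≟ a
    ... | _        | _        | yes refl = inj₂ ∈ᵛ-here
    ... | _        | yes refl | no  _    = inj₂ (∈ᵛ-there v∈C)
    ... | yes refl | no  y≢v  | no  y≢a  = ⊥-elim ([ y≢v , y≢a ]′ (N[u]⊆va Gxy))
    ... | no  x≢u  | no  y≢v  | no  y≢a  = CoveredBy-∷ covers (trans (contracted-other x≢u y≢v y≢a) Gxy)
  ... | no  v∉C = inj₁ u , covers-u
    where
    joined⇒∈C : ∀ {x} → x ≢ u → G x v ∨ G x a ≡ true → inj₁ x ∈ᵛ C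
    joined⇒∈C x≢u joined = [ id , flip contradiction v∉C ]′ (covers (trans (contracted-v x≢u) joined))

    covers-u : CoveredBy G (inj₁ u ∷ᶠ C)
    covers-u {x} {y} Gxy with x ≟ u
    ... | yes refl = inj₁ ∈ᵛ-here
    ... | no  x≢u  with y ≟ v | y ≟ a
    ...   | no  y≢v  | no  y≢a  = CoveredBy-∷ covers (trans (contracted-other x≢u y≢v y≢a) Gxy)
    ...   | yes refl | _        = inj₁ (∈ᵛ-there (joined⇒∈C x≢u (cong (_∨ G x a) Gxy)))
    ...   | no  _    | yes refl =
      inj₁ (∈ᵛ-there (joined⇒∈C x≢u (trans (cong (G x v ∨_) Gxy) (∨-zeroʳ (G x v)))))

  -- The edge of M at the merged vertex is sent back to whichever of v, a its left end sees in G,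
  -- and u is matched to the other one.
  module _ {m} (M : Matching m contracted) where

    u-unmatched : ∀ i → leftEnd M i ≢ u
    u-unmatched i = edge⇒≢u (matched M i)

    module _ (i₁ : Fin m) (i₁↦v : rightEnd M i₁ ≡ v) where

      others-avoid : ∀ i → i ≢ i₁ → ∀ {w} → w ≡ v ⊎ w ≡ a → rightEnd M i ≢ w
      others-avoid i i≢i₁ (inj₁ refl) i↦v = i≢i₁ (rightEnd-injective M (trans i↦v (sym i₁↦v)))
      others-avoid i i≢i₁ (inj₂ refl)     = edge⇒≢a (matched M i)

      rematched : ∀ {w w′} → w ≢ w′ → w ≡ v ⊎ w ≡ a → w′ ≡ v ⊎ w′ ≡ a →
                  G (leftEnd M i₁) w ≡ true → G u w′ ≡ true → Matching (suc m) G
      rematched {w} {w′} w≢w′ w∈va w′∈va x₁w uw′ = Matching-∷ M′ uw′ u-unmatched w′-unmatched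
        where
        M′ : Matching m G
        M′ = Matching-rematch M i₁ (λ i i≢i₁ → others-avoid i i≢i₁ w∈va)
                                   (λ i i≢i₁ → edge⇒G (matched M i) (others-avoid i i≢i₁ (inj₁ refl))) x₁w

        w′-unmatched : ∀ i → rightEnd M′ i ≢ w′
        w′-unmatched i with i ≟ i₁
        ... | yes refl = w≢w′ ∘ trans (sym (updateAt-updates i₁ (rightEnd M)))
        ... | no  i≢i₁ = others-avoid i i≢i₁ w′∈va ∘ trans (sym (updateAt-minimal i i₁ (rightEnd M) i≢i₁))

      x₁-joined : G (leftEnd M i₁) v ∨ G (leftEnd M i₁) a ≡ true
      x₁-joined = trans (sym (contracted-v (u-unmatched i₁)))
                        (subst (λ y → contracted (leftEnd M i₁) y ≡ true) i₁↦v (matched M i₁))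

      liftMatchingAt : Matching (suc m) G
      liftMatchingAt with G (leftEnd M i₁) v in x₁v
      ... | true  = rematched (a≢v ∘ sym) (inj₁ refl) (inj₂ refl) x₁v ua
      ... | false = rematched a≢v (inj₂ refl) (inj₁ refl) x₁a uv
        where
        x₁a : G (leftEnd M i₁) a ≡ true
        x₁a = subst (λ b → b ∨ G (leftEnd M i₁) a ≡ true) x₁v x₁-joined

    liftMatching : Matching (suc m) G
    liftMatching with any? (λ i → rightEnd M i ≟ v)
    ... | yes (i₁ , i₁↦v) = liftMatchingAt i₁ i₁↦v
    ... | no  v-unmatched =
      Matching-∷ (Matching-transfer M λ i → edge⇒G (matched M i) (v-unmatched ∘ (i ,_))) uv u-unmatched
                 (λ i → v-unmatched ∘ (i ,_))

  liftPair : KönigPair contracted → KönigPair G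
  liftPair (königPair M C covers c≤m) = königPair (liftMatching M) (proj₁ lifted ∷ᶠ C) (proj₂ lifted) (s≤s c≤m)
    where lifted = liftCover covers

module KönigStep {n} (G : BipGraph n) (rec : ∀ {H : BipGraph n} → edgeCount H < edgeCount G → KönigPair H)
                 {u v} (uv : G u v ≡ true) where

  isV? : ∀ (x y : Fin n) → Dec (y ≡ v)
  isV? _ y = y ≟ v

  open KönigPair (rec {G ∖ isV?} (edgeCount-∖ {G = G} isV? uv refl)) using ()
    renaming (matchingSize to m₁; matching to M₁; cover to C₁; covers to C₁-covers; cover≤matching to c₁≤m₁)

  M₁-in-G : ∀ i → G (leftEnd M₁ i) (rightEnd M₁ i) ≡ true
  M₁-in-G i = ∖-⊆ isV? (matched M₁ i)

  v-unmatched₁ : ∀ i → rightEnd M₁ i ≢ v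
  v-unmatched₁ i = proj₂ (∖-edge⁻ isV? (matched M₁ i))

  withLargerMatching : Matching (suc m₁) G → KönigPair G
  withLargerMatching M =
    königPair M (inj₂ v ∷ᶠ C₁) (CoveredBy-∖ isV? (CoveredBy-∷ C₁-covers) λ { refl → inj₂ ∈ᵛ-here }) (s≤s c₁≤m₁)

  module MatchedAt (i₀ : Fin m₁) (i₀↦u : leftEnd M₁ i₀ ≡ u) where

    a : Fin n
    a = rightEnd M₁ i₀

    ua : G u a ≡ true
    ua = subst (λ x → G x a ≡ true) i₀↦u (M₁-in-G i₀)

    module ThirdNeighbour {b} (ub : G u b ≡ true) (b≢v : b ≢ v) (b≢a : b ≢ a) where

      isUB? : ∀ x y → Dec (x ≡ u × y ≡ b)
      isUB? x y = (x ≟ u) ×-dec (y ≟ b)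

      open KönigPair (rec {G ∖ isUB?} (edgeCount-∖ {G = G} isUB? ub (refl , refl))) using ()
        renaming (matchingSize to m₂; matching to M₂; cover to C₂; covers to C₂-covers; cover≤matching to c₂≤m₂)

      M₁-avoids-ub : ∀ i → (G ∖ isUB?) (leftEnd M₁ i) (rightEnd M₁ i) ≡ true
      M₁-avoids-ub i = ∖-edge⁺ isUB? (M₁-in-G i) λ (i↦u , i↦b) →
        b≢a (trans (sym i↦b) (cong (rightEnd M₁) (leftEnd-injective M₁ (trans i↦u (sym i₀↦u)))))

      M₂-in-G : Matching m₂ G
      M₂-in-G = Matching-transfer M₂ (λ i → ∖-⊆ isUB? (matched M₂ i))

      pair : KönigPair G
      pair with (inj₁ u ∈ᵛ? C₂) ⊎-dec (inj₂ b ∈ᵛ? C₂)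
      ... | yes ub-covered   =
        königPair M₂-in-G C₂ (CoveredBy-∖ isUB? C₂-covers λ { (refl , refl) → ub-covered }) c₂≤m₂
      ... | no  ub-uncovered = withLargerMatching (Matching-≤ m₁<m₂ M₂-in-G)
        where
        -- C₂ must contain v to cover uv, besides an endpoint of each edge of M₁ (which avoids v).
        v∈C₂ : inj₂ v ∈ᵛ C₂
        v∈C₂ = [ flip contradiction ub-uncovered ∘ inj₁ , id ]′
                 (C₂-covers (∖-edge⁺ isUB? uv (b≢v ∘ sym ∘ proj₂)))

        m₁<m₂ : suc m₁ ≤ m₂
        m₁<m₂ = ≤-trans (cover-exceeds-matching (Matching-transfer M₁ M₁-avoids-ub) C₂-covers v∈C₂ v-unmatched₁)
                        c₂≤m₂

    pair : KönigPair G
    pair with any? (λ b → (G u b ≟ᵇ true) ×-dec (¬? (b ≟ v) ×-dec ¬? (b ≟ a)))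
    ... | yes (b , ub , b≢v , b≢a) = ThirdNeighbour.pair ub b≢v b≢a
    ... | no  noThird = liftPair (rec {contracted} edgeCount-contracted)
      where
      N[u]⊆va : ∀ {y} → G u y ≡ true → y ≡ v ⊎ y ≡ a
      N[u]⊆va {y} uy with y ≟ v | y ≟ a
      ... | yes y≡v | _       = inj₁ y≡v
      ... | no  _   | yes y≡a = inj₂ y≡a
      ... | no  y≢v | no  y≢a = contradiction (y , uy , y≢v , y≢a) noThird

      open Contraction G uv ua (v-unmatched₁ i₀) N[u]⊆va

  pair : KönigPair G
  pair with any? (λ i → leftEnd M₁ i ≟ u)
  ... | yes (i₀ , i₀↦u) = MatchedAt.pair i₀ i₀↦u
  ... | no  u-unmatched  =
    withLargerMatching (Matching-∷ (Matching-transfer M₁ M₁-in-G) uv (λ i → u-unmatched ∘ (i ,_)) v-unmatched₁)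

königStep : ∀ {n} (G : BipGraph n) → (∀ {H : BipGraph n} → edgeCount H < edgeCount G → KönigPair H) →
  KönigPair G
königStep G rec with any? (λ x → any? (λ y → G x y ≟ᵇ true))
... | yes (u , v , uv) = KönigStep.pair G rec uv
... | no  edgeless     =
  königPair emptyMatching (λ ()) (λ {x} {y} Gxy → contradiction (x , y , Gxy) edgeless) z≤n

könig : ∀ {n} (G : BipGraph n) → KönigPair G
könig = WF.All.wfRec (On.wellFounded edgeCount <-wellFounded) _ KönigPair königStep

smallVertexCover : ∀ {n} (G : BipGraph n) k → ¬ HasMatching (suc k) G →
  ∃₂ λ CL CR → IsVertexCover G CL CR × ∣ CL ∣ + ∣ CR ∣ ≤ k
smallVertexCover G k noMatching with könig G
... | königPair {m} {c} M C covers c≤m =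
  proj₁ (vertexSubsets C) , proj₂ (vertexSubsets C) , CoveredBy⇒IsVertexCover covers ,
  ≤-trans (size-vertexSubsets C) (≤-trans c≤m m≤k)
  where
  m≤k : m ≤ k
  m≤k = decidable-stable (m ≤? k) (noMatching ∘ Matching⇒HasMatching ∘ flip Matching-≤ M ∘ ≰⇒>)

-- The upper bound

leftCopiesKst-≤ : ∀ {n} {G : BipGraph n} {CL CR} s t → IsVertexCover G CL CR →
  leftCopiesKst s t G ≤ (∣ CL ∣ C s) * (n C t) + (n C s) * (∣ CR ∣ C t)
leftCopiesKst-≤ {n} {G} {CL} {CR} s t cover = begin
  leftCopiesKst s t G
    ≤⟨ pairSum-mono-≤ (λ A B → ind-∧-≤ (ofSize s A) (ofSize t B) (completeSide A B)) ⟩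
  pairSum (λ A B → s⊆CL A * sizeT B + sizeS A * t⊆CR B)
    ≡⟨ pairSum-+ (λ A B → s⊆CL A * sizeT B) (λ A B → sizeS A * t⊆CR B) ⟩
  pairSum (λ A B → s⊆CL A * sizeT B) + pairSum (λ A B → sizeS A * t⊆CR B)
    ≡⟨ cong₂ _+_ (pairSum-* s⊆CL sizeT) (pairSum-* sizeS t⊆CR) ⟩
  subsetSum s⊆CL * subsetSum sizeT + subsetSum sizeS * subsetSum t⊆CR
    ≡⟨ cong₂ _+_ (cong₂ _*_ (#subsetsOfSizeWithin CL s) (#subsetsOfSize n t))
                 (cong₂ _*_ (#subsetsOfSize n s) (#subsetsOfSizeWithin CR t)) ⟩
  (∣ CL ∣ C s) * (n C t) + (n C s) * (∣ CR ∣ C t) ∎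
  where
  open ≤-Reasoning
  sizeS sizeT s⊆CL t⊆CR : Subset n → ℕ
  sizeS A = ind (ofSize s A)
  sizeT B = ind (ofSize t B)
  s⊆CL A = ind (ofSize s A ∧ within CL A)
  t⊆CR B = ind (ofSize t B ∧ within CR B)

  completeSide : ∀ A B → T (completeBetween G A B) → T (within CL A) ⊎ T (within CR B)
  completeSide A B complete =
    Sum.map (Equivalence.from T-≡ ∘ dec-true (A ⊆? CL)) (Equivalence.from T-≡ ∘ dec-true (B ⊆? CR))
            (Complete⇒⊆⊎⊆ cover (Equivalence.to completeBetween⇔Complete complete))

copiesKst-≤-≢ : ∀ {n k s t} (G : BipGraph n) → ¬ HasMatching (suc k) G → s ≢ t → 1 ≤ s → 1 ≤ t →
  copiesKst s t G ≤ (k C s) * (n C t) + (k C t) * (n C s)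
copiesKst-≤-≢ {n} {k} {s} {t} G noMatching s≢t 1≤s 1≤t with smallVertexCover G k noMatching
... | CL , CR , cover , a+b≤k = begin
  copiesKst s t G
    ≡⟨ copiesKst-≢ G s≢t ⟩
  leftCopiesKst s t G + leftCopiesKst t s G
    ≤⟨ +-mono-≤ (leftCopiesKst-≤ s t cover) (leftCopiesKst-≤ t s cover) ⟩
  ((a C s) * (n C t) + (n C s) * (b C t)) + ((a C t) * (n C s) + (n C t) * (b C s))
    ≡⟨ regroup (a C s) (b C t) (a C t) (b C s) (n C s) (n C t) ⟩
  (a C s + b C s) * (n C t) + (a C t + b C t) * (n C s)
    ≤⟨ +-mono-≤ (*-monoˡ-≤ (n C t) (C-superadditive s 1≤s a+b≤k))
                (*-monoˡ-≤ (n C s) (C-superadditive t 1≤t a+b≤k)) ⟩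
  (k C s) * (n C t) + (k C t) * (n C s) ∎
  where
  open ≤-Reasoning
  open +-*-Solver
  a = ∣ CL ∣
  b = ∣ CR ∣
  regroup : ∀ x y z w p q → (x * q + p * y) + (z * p + q * w) ≡ (x + w) * q + (z + y) * p
  regroup = solve 6 (λ x y z w p q → (x :* q :+ p :* y) :+ (z :* p :+ q :* w)
                                   := (x :+ w) :* q :+ (z :+ y) :* p) refl

copiesKst-≤-≡ : ∀ {n k s} (G : BipGraph n) → ¬ HasMatching (suc k) G → 1 ≤ s → copiesKst s s G ≤ (k C s) * (n C s)
copiesKst-≤-≡ {n} {k} {s} G noMatching 1≤s with smallVertexCover G k noMatching
... | CL , CR , cover , a+b≤k = begin
  copiesKst s s G                                  ≡⟨ copiesKst-≡ G ⟩
  leftCopiesKst s s G                              ≤⟨ leftCopiesKst-≤ s s cover ⟩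
  (∣ CL ∣ C s) * (n C s) + (n C s) * (∣ CR ∣ C s)  ≡⟨ cong ((∣ CL ∣ C s) * (n C s) +_) (*-comm (n C s) (∣ CR ∣ C s)) ⟩
  (∣ CL ∣ C s) * (n C s) + (∣ CR ∣ C s) * (n C s)  ≡⟨ *-distribʳ-+ (n C s) (∣ CL ∣ C s) (∣ CR ∣ C s) ⟨
  (∣ CL ∣ C s + ∣ CR ∣ C s) * (n C s)              ≤⟨ *-monoˡ-≤ (n C s) (C-superadditive s 1≤s a+b≤k) ⟩
  (k C s) * (n C s)                                ∎
  where open ≤-Reasoning

-- The extremal graph

joinedToAll : ∀ {n} → Subset n → BipGraph n
joinedToAll K x y = lookup K x

Complete-joinedToAll⇔⊆ : ∀ {n} {K A B : Subset n} → Nonempty B → Complete (joinedToAll K) A B ⇔ A ⊆ K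
Complete-joinedToAll⇔⊆ {K = K} (y , y∈B) = mk⇔
  (λ complete {x} x∈A → lookup⇒[]= x K (complete x∈A y∈B))
  (λ A⊆K {_} {_} x∈A _ → []=⇒lookup (A⊆K x∈A))

completeBetween-joinedToAll : ∀ {n} {K A B : Subset n} → Nonempty B →
  completeBetween (joinedToAll K) A B ≡ does (A ⊆? K)
completeBetween-joinedToAll {K = K} {A} B≢∅ =
  det (fromEquivalence (Equivalence.to complete⇔⊆) (Equivalence.from complete⇔⊆)) (proof (A ⊆? K))
  where complete⇔⊆ = Complete-joinedToAll⇔⊆ B≢∅ ⇔-∘ completeBetween⇔Complete

leftCopiesKst-joinedToAll : ∀ {n} (K : Subset n) s t → 1 ≤ t →
  leftCopiesKst s t (joinedToAll K) ≡ (∣ K ∣ C s) * (n C t)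
leftCopiesKst-joinedToAll {n} K s t 1≤t = begin
  leftCopiesKst s t (joinedToAll K)
    ≡⟨ pairSum-cong (λ A B →
         ind-∧-≡ (ofSize s A) (ofSize t B) (completeBetween-joinedToAll {K = K} {A} ∘ nonempty B)) ⟩
  pairSum (λ A B → s⊆K A * sizeT B)  ≡⟨ pairSum-* s⊆K sizeT ⟩
  subsetSum s⊆K * subsetSum sizeT    ≡⟨ cong₂ _*_ (#subsetsOfSizeWithin K s) (#subsetsOfSize n t) ⟩
  (∣ K ∣ C s) * (n C t)              ∎
  where
  open ≡-Reasoning
  s⊆K sizeT : Subset n → ℕ
  s⊆K A = ind (ofSize s A ∧ within K A)
  sizeT B = ind (ofSize t B)
  nonempty : ∀ (B : Subset n) → T (ofSize t B) → Nonempty B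
  nonempty B ∣B∣≡t with nonempty? B
  ... | yes B≢∅     = B≢∅
  ... | no  B-empty =
    contradiction (trans (sym (≡ᵇ⇒≡ ∣ B ∣ t ∣B∣≡t)) (trans (cong ∣_∣ (Empty-unique B-empty)) (∣⊥∣≡0 n)))
                  (>⇒≢ 1≤t)

firstVertices : ∀ n → ℕ → Subset n
firstVertices zero    k       = []
firstVertices (suc n) zero    = ∅
firstVertices (suc n) (suc k) = inside ∷ firstVertices n k

∣firstVertices∣≡k : ∀ {n k} → k ≤ n → ∣ firstVertices n k ∣ ≡ k
∣firstVertices∣≡k {zero}          z≤n       = refl
∣firstVertices∣≡k {suc n} {zero}  _         = ∣⊥∣≡0 (suc n)
∣firstVertices∣≡k {suc n} {suc k} (s≤s k≤n) = cong suc (∣firstVertices∣≡k k≤n)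

∈firstVertices⇒< : ∀ {n k} {x : Fin n} → x ∈ firstVertices n k → toℕ x < k
∈firstVertices⇒< {suc n} {zero}  x∈∅         = contradiction x∈∅ ∉⊥
∈firstVertices⇒< {suc n} {suc k} here        = s≤s z≤n
∈firstVertices⇒< {suc n} {suc k} (there x∈K) = s≤s (∈firstVertices⇒< x∈K)

extremalGraph : ∀ n → ℕ → BipGraph n
extremalGraph n k = joinedToAll (firstVertices n k)

extremalGraph-noMatching : ∀ {n} k → ¬ HasMatching (suc k) (extremalGraph n k)
extremalGraph-noMatching {n} k (f , _ , f-injective , _ , edge) = 1+n≰n (injective⇒≤ index-injective)
  where
  index : Fin (suc k) → Fin k
  index i = fromℕ< (∈firstVertices⇒< (lookup⇒[]= (f i) (firstVertices n k) (edge i)))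

  index-injective : Injective _≡_ _≡_ index
  index-injective {i} {j} index≡ =
    f-injective (toℕ-injective (trans (sym (toℕ-fromℕ< _)) (trans (cong toℕ index≡) (toℕ-fromℕ< _))))

leftCopiesKst-extremalGraph : ∀ {n k} s t → k ≤ n → 1 ≤ t →
  leftCopiesKst s t (extremalGraph n k) ≡ (k C s) * (n C t)
leftCopiesKst-extremalGraph {n} {k} s t k≤n 1≤t =
  trans (leftCopiesKst-joinedToAll (firstVertices n k) s t 1≤t)
        (cong (λ m → (m C s) * (n C t)) (∣firstVertices∣≡k k≤n))

theorem1p4 : (k s t n : ℕ) → 1 ≤ k → 1 ≤ s → 1 ≤ t → n ≥ k →
    (s ≢ t → IsExBipKstM n s t (suc k) ((k C s) * (n C t) + (k C t) * (n C s)))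
    × (s ≡ t → IsExBipKstM n s t (suc k) ((k C s) * (n C s)))
theorem1p4 k s t n _ 1≤s 1≤t k≤n = distinct , equal
  where
  distinct : s ≢ t → IsExBipKstM n s t (suc k) ((k C s) * (n C t) + (k C t) * (n C s))
  distinct s≢t =
    (λ G noMatching → copiesKst-≤-≢ G noMatching s≢t 1≤s 1≤t) ,
    extremalGraph n k , extremalGraph-noMatching k ,
    trans (copiesKst-≢ (extremalGraph n k) s≢t)
          (cong₂ _+_ (leftCopiesKst-extremalGraph s t k≤n 1≤t) (leftCopiesKst-extremalGraph t s k≤n 1≤s))

  equal : s ≡ t → IsExBipKstM n s t (suc k) ((k C s) * (n C s))
  equal refl =
    (λ G noMatching → copiesKst-≤-≡ G noMatching 1≤s) ,
    extremalGraph n k , extremalGraph-noMatching k ,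
    trans (copiesKst-≡ (extremalGraph n k)) (leftCopiesKst-extremalGraph s s k≤n 1≤s)
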